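{- For $n\le 2$, the augmented hypercube $AQ_n$ is arc-transitive, but for $n\ge 3$, $AQ_n$ is neither arc-transitive nor edge-transitive.
   Context: The augmented hypercube $AQ_n$ ($n\ge1$) has vertex set $\mathbb{Z}_2^n$; two vertices are adjacent iff either they differ in exactly one position, or for some $0\le \ell\le n-2$ they agree in the first $\ell$ positions and differ in all of the remaining $n-\ell$ positions. A graph is arc-transitive if its automorphism group acts transitively on ordered pairs of adjacent vertices, and edge-transitive if it acts transitively on edges. -}

module Defs where

open import Data.Nat using (ℕ; _≤_; _<_; _+_)
open import Data.Bool using (Bool)
open import Data.Fin using (Fin; toℕ)
open import Data.Vec using (Vec; lookup)
open import Data.Product using (Σ; ∃; _×_; _,_)
open import Data.Sum using (_⊎_)
open import Relation.Binary.PropositionalEquality using (_≡_; _≢_)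
open import Function.Definitions using (Bijective)
open import Function.Bundles using (_⇔_)

-- Vertices of AQ_n: binary strings of length n; position i is `lookup u i`
-- (positions 0 .. n-1, so "the first ℓ positions" are those with toℕ i < ℓ).
V : ℕ → Set
V n = Vec Bool n

HypercubeAdj : ∀ {n} → V n → V n → Set
HypercubeAdj {n} u v =
  Σ (Fin n) λ i → (lookup u i ≢ lookup v i) × (∀ j → j ≢ i → lookup u j ≡ lookup v j)

ComplementAdj : ∀ {n} → V n → V n → Set
ComplementAdj {n} u v =
  Σ ℕ λ ℓ → (ℓ + 2 ≤ n) ×
    ((∀ j → toℕ j < ℓ → lookup u j ≡ lookup v j) ×
     (∀ j → ℓ ≤ toℕ j → lookup u j ≢ lookup v j))

Adj : ∀ {n} → V n → V n → Set
Adj u v = HypercubeAdj u v ⊎ ComplementAdj u v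

IsAutomorphism : ∀ n → (V n → V n) → Set
IsAutomorphism n f = Bijective _≡_ _≡_ f × (∀ u v → Adj u v ⇔ Adj (f u) (f v))

ArcTransitive : ℕ → Set
ArcTransitive n =
  ∀ (u v x y : V n) → Adj u v → Adj x y →
    ∃ λ f → IsAutomorphism n f × (f u ≡ x × f v ≡ y)

EdgeTransitive : ℕ → Set
EdgeTransitive n =
  ∀ (u v x y : V n) → Adj u v → Adj x y →
    ∃ λ f → IsAutomorphism n f × ((f u ≡ x × f v ≡ y) ⊎ (f u ≡ y × f v ≡ x))

-- For n ≤ 2 any two distinct vertices of AQ_n are adjacent, so AQ_n is complete and a
-- composite of two transpositions of vertices carries any arc onto any other.
-- For n ≥ 3 compare common neighbours of the ends of an edge, a number preserved by
-- automorphisms. The edge 0…000 — 0…011 has the three common neighbours 0…100,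
-- 0…010 and 0…001. The edge 0x — 1x has at most two: a short case analysis shows
-- that a common neighbour is joined to both ends by complement edges, and as the
-- ends differ in the first position one of these edges has ℓ = 0, so the tail of
-- the neighbour is the complement of x.
module Submission where

open import Defs
open import Data.Nat using (ℕ; zero; suc; _≤_; _+_; s≤s; z≤n; z<s)
open import Data.Nat.Properties
  using (≤-reflexive; <-≤-trans; m≤n⇒m≤1+n; m<m+n; m+n≤o⇒m≤o∸n)
open import Data.Bool using (Bool; true; false; not)
open import Data.Bool.Properties using (not-¬; ¬-not) renaming (_≟_ to _≟ᵇ_)
open import Data.Fin using (Fin; zero; suc; fromℕ; fromℕ<; inject₁)
open import Data.Fin.Properties
  using (toℕ-fromℕ; toℕ-inject₁; toℕ-fromℕ<; fromℕ≢inject₁) renaming (_≟_ to _≟ᶠ_)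
open import Data.Vec using (Vec; []; _∷_; lookup; head; map; replicate; updateAt)
open import Data.Vec.Properties
  using (≡-dec; ∷-injectiveʳ; lookup-map; lookup∘updateAt; lookup∘updateAt′;
         tabulate∘lookup; tabulate-cong)
open import Data.Product using (_×_; _,_; proj₁; ∃₂; swap)
open import Data.Sum using (_⊎_; inj₁; inj₂; [_,_]′)
open import Data.Empty using (⊥; ⊥-elim)
open import Function using (_∘_)
open import Function.Bundles using (Equivalence; mk⇔; mk↔ₛ′; Bijection)
open import Function.Definitions using (Bijective; Injective)
open import Function.Properties.Inverse using (↔⇒⤖)
import Function.Construct.Composition as Compose
open import Relation.Nullary using (¬_; yes; no)
open import Relation.Nullary.Decidable using (decidable-stable)
open import Relation.Binary.Definitions using (DecidableEquality)
open import Relation.Binary.PropositionalEquality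
  using (_≡_; _≢_; refl; sym; trans; cong; cong₂; subst; subst₂; ≢-sym)

private
  variable
    n : ℕ
    p q c : Bool
    x y : V n
    A : Set

lookup-injective : {xs ys : Vec A n} → (∀ i → lookup xs i ≡ lookup ys i) → xs ≡ ys
lookup-injective {xs = xs} {ys} same =
  trans (sym (tabulate∘lookup xs)) (trans (tabulate-cong same) (tabulate∘lookup ys))

involutive⇒bijective : (f : A → A) → (∀ a → f (f a) ≡ a) → Bijective _≡_ _≡_ f
involutive⇒bijective f inv = Bijection.bijective (↔⇒⤖ (mk↔ₛ′ f f inv inv))

module Transposition (_≟_ : DecidableEquality A) where

  transpose : A → A → A → A
  transpose a b w with w ≟ a | w ≟ b
  ... | yes _ | _     = b
  ... | no _  | yes _ = a
  ... | no _  | no _  = w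

  transpose-matchˡ : ∀ a b → transpose a b a ≡ b
  transpose-matchˡ a b with a ≟ a
  ... | yes _  = refl
  ... | no a≢a = ⊥-elim (a≢a refl)

  transpose-matchʳ : ∀ a b → transpose a b b ≡ a
  transpose-matchʳ a b with b ≟ a | b ≟ b
  ... | yes b≡a | _      = b≡a
  ... | no _    | yes _  = refl
  ... | no _    | no b≢b = ⊥-elim (b≢b refl)

  transpose-other : ∀ a b w → w ≢ a → w ≢ b → transpose a b w ≡ w
  transpose-other a b w w≢a w≢b with w ≟ a | w ≟ b
  ... | yes w≡a | _       = ⊥-elim (w≢a w≡a)
  ... | no _    | yes w≡b = ⊥-elim (w≢b w≡b)
  ... | no _    | no _    = refl

  transpose-involutive : ∀ a b w → transpose a b (transpose a b w) ≡ w
  transpose-involutive a b w with w ≟ a | w ≟ b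
  ... | yes refl | _        = transpose-matchʳ w b
  ... | no _     | yes refl = transpose-matchˡ a w
  ... | no w≢a   | no w≢b   = transpose-other a b w w≢a w≢b

  transpose-bijective : ∀ a b → Bijective _≡_ _≡_ (transpose a b)
  transpose-bijective a b = involutive⇒bijective (transpose a b) (transpose-involutive a b)

adj-irrefl : {u v : V n} → Adj u v → u ≢ v
adj-irrefl (inj₁ (_ , differ , _)) refl = differ refl
adj-irrefl (inj₂ (ℓ , ℓ+2≤n , _ , differ)) refl =
  differ (fromℕ< ℓ<n) (≤-reflexive (sym (toℕ-fromℕ< ℓ<n))) refl
  where ℓ<n = <-≤-trans (m<m+n ℓ z<s) ℓ+2≤n

hypercubeAdj-∷⁺ : {u v : V n} → HypercubeAdj u v → HypercubeAdj (c ∷ u) (c ∷ v)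
hypercubeAdj-∷⁺ (i , differ , agree) =
  suc i , differ , λ { zero _ → refl ; (suc j) j≢i → agree j (j≢i ∘ cong suc) }

complementAdj-∷⁺ : {u v : V n} → ComplementAdj u v → ComplementAdj (c ∷ u) (c ∷ v)
complementAdj-∷⁺ (ℓ , ℓ+2≤n , agree , differ) =
  suc ℓ , s≤s ℓ+2≤n ,
  (λ { zero _ → refl ; (suc j) (s≤s j<ℓ) → agree j j<ℓ }) ,
  (λ { zero () ; (suc j) (s≤s ℓ≤j) → differ j ℓ≤j })

adj-∷⁺ : {u v : V n} → Adj u v → Adj (c ∷ u) (c ∷ v)
adj-∷⁺ (inj₁ h) = inj₁ (hypercubeAdj-∷⁺ h)
adj-∷⁺ (inj₂ h) = inj₂ (complementAdj-∷⁺ h)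

hypercubeAdj-updateAt : (u : V n) (i : Fin n) → HypercubeAdj u (updateAt u i not)
hypercubeAdj-updateAt u i =
  i , (λ eq → not-¬ refl (trans eq (lookup∘updateAt i u))) ,
  (λ j j≢i → sym (lookup∘updateAt′ j i j≢i u))

complementAdj-map-not : (u : V (suc (suc n))) → ComplementAdj u (map not u)
complementAdj-map-not u =
  0 , s≤s (s≤s z≤n) , (λ _ ()) , (λ j _ eq → not-¬ refl (trans eq (lookup-map j not u)))

hypercubeAdj-unique : {u v : V n} {i j : Fin n} → HypercubeAdj u v →
                      lookup u i ≢ lookup v i → lookup u j ≢ lookup v j → i ≡ j
hypercubeAdj-unique {u = u} {v} (k , _ , agree) differᵢ differⱼ =
  trans (atK differᵢ) (sym (atK differⱼ))
  where
  atK : ∀ {i} → lookup u i ≢ lookup v i → i ≡ k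
  atK {i} differ = decidable-stable (i ≟ᶠ k) (differ ∘ agree i)

complementAdj-last-two : {u v : V (suc (suc n))} → ComplementAdj u v →
                         lookup u (fromℕ (suc n)) ≢ lookup v (fromℕ (suc n)) ×
                         lookup u (inject₁ (fromℕ n)) ≢ lookup v (inject₁ (fromℕ n))
complementAdj-last-two {n = n} (ℓ , ℓ+2≤n , _ , differ) =
  differ _ (subst (ℓ ≤_) (sym (toℕ-fromℕ (suc n))) (m≤n⇒m≤1+n ℓ≤n)) ,
  differ _ (subst (ℓ ≤_) (sym (trans (toℕ-inject₁ (fromℕ n)) (toℕ-fromℕ n))) ℓ≤n)
  where
  ℓ≤n : ℓ ≤ n
  ℓ≤n = m+n≤o⇒m≤o∸n ℓ ℓ+2≤n

IsComplete : ℕ → Set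
IsComplete n = ∀ {u v : V n} → u ≢ v → Adj u v

complete⇒automorphism : IsComplete n → {f : V n → V n} → Bijective _≡_ _≡_ f → IsAutomorphism n f
complete⇒automorphism complete {f} f-bijective@(f-injective , _) = f-bijective , λ u v →
  mk⇔ (λ uv → complete (adj-irrefl {u = u} {v} uv ∘ f-injective))
      (λ fufv → complete (adj-irrefl {u = f u} {f v} fufv ∘ cong f))

complete⇒arcTransitive : IsComplete n → ArcTransitive n
complete⇒arcTransitive complete u v x y uv xy =
  σ ∘ τ , complete⇒automorphism complete (Compose.bijective _≡_ _≡_ _≡_ τ-bijective σ-bijective) ,
  στu≡x , transpose-matchˡ (τ v) y
  where
  open Transposition (≡-dec _≟ᵇ_)
  τ σ : V _ → V _
  τ = transpose u x
  σ = transpose (τ v) y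
  τ-bijective = transpose-bijective u x
  σ-bijective = transpose-bijective (τ v) y
  x≢τv : x ≢ τ v
  x≢τv x≡τv = adj-irrefl {u = u} {v} uv (proj₁ τ-bijective (trans (transpose-matchˡ u x) x≡τv))
  στu≡x : σ (τ u) ≡ x
  στu≡x = trans (cong σ (transpose-matchˡ u x))
                (transpose-other (τ v) y x x≢τv (adj-irrefl {u = x} {y} xy))

AQ₁-complete : IsComplete 1
AQ₁-complete {a ∷ []} {c ∷ []} u≢v =
  inj₁ (zero , u≢v ∘ cong (_∷ []) , λ { zero 0≢0 → ⊥-elim (0≢0 refl) })

AQ₂-complete : IsComplete 2
AQ₂-complete {a ∷ b ∷ []} {c ∷ d ∷ []} u≢v with a ≟ᵇ c | b ≟ᵇ d
... | yes refl | yes refl = ⊥-elim (u≢v refl)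
... | no a≢c   | yes refl =
  inj₁ (zero , a≢c , λ { zero 0≢0 → ⊥-elim (0≢0 refl) ; (suc zero) _ → refl })
... | yes refl | no b≢d   =
  inj₁ (suc zero , b≢d , λ { zero _ → refl ; (suc zero) 1≢1 → ⊥-elim (1≢1 refl) })
... | no a≢c   | no b≢d   =
  inj₂ (0 , s≤s (s≤s z≤n) , (λ _ ()) , λ { zero _ → a≢c ; (suc zero) _ → b≢d })

arcTransitive⇒edgeTransitive : ArcTransitive n → EdgeTransitive n
arcTransitive⇒edgeTransitive at u v x y uv xy =
  let f , f-automorphism , arc = at u v x y uv xy in f , f-automorphism , inj₁ arc

hypercubeAdj-∷⁻ : HypercubeAdj (p ∷ x) (c ∷ y) → p ≢ c → x ≡ y
hypercubeAdj-∷⁻ (zero  , _ , agree) _   = lookup-injective (λ j → agree (suc j) λ ())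
hypercubeAdj-∷⁻ (suc _ , _ , agree) p≢c = ⊥-elim (p≢c (agree zero λ ()))

complementAdj-∷⁻ : ComplementAdj (p ∷ x) (c ∷ y) → p ≡ c ⊎ y ≡ map not x
complementAdj-∷⁻ {x = x} (zero , _ , _ , differ) =
  inj₂ (lookup-injective λ j →
    trans (¬-not (≢-sym (differ (suc j) z≤n))) (sym (lookup-map j not x)))
complementAdj-∷⁻ (suc _ , _ , agree , _) = inj₁ (agree zero (s≤s z≤n))

¬hypercubeAdj×complementAdj : {x : V (suc (suc n))} {w : V (3 + n)} →
                              HypercubeAdj (p ∷ x) w → ComplementAdj (q ∷ x) w → ⊥
-- Both positions lie in the tail x, where p ∷ x and q ∷ x agree.
¬hypercubeAdj×complementAdj {p = p} {q = q} {x = x} {w} hyp comp =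
  let differ₁ , differ₂ = complementAdj-last-two {u = q ∷ x} {w} comp
  in fromℕ≢inject₁ (hypercubeAdj-unique {u = p ∷ x} {w} hyp differ₁ differ₂)

¬hypercubeAdj×hypercubeAdj : p ≢ q → HypercubeAdj (p ∷ x) (c ∷ y) →
                             HypercubeAdj (q ∷ x) (c ∷ y) → ⊥
¬hypercubeAdj×hypercubeAdj {p = p} {q} {c = c} p≢q hypP hypQ with p ≟ᵇ c
... | yes refl = adj-irrefl (inj₁ hypP) (cong (p ∷_) (hypercubeAdj-∷⁻ hypQ (≢-sym p≢q)))
... | no p≢c   = adj-irrefl (inj₁ hypQ) (cong₂ _∷_ q≡c (hypercubeAdj-∷⁻ hypP p≢c))
  where
  q≡c : q ≡ c
  q≡c = trans (¬-not (≢-sym p≢q)) (sym (¬-not (≢-sym p≢c)))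

CommonNeighbour : V n → V n → V n → Set
CommonNeighbour a b w = Adj a w × Adj b w

commonNeighbour-tail : {x : V (suc (suc n))} → p ≢ q →
                       CommonNeighbour (p ∷ x) (q ∷ x) (c ∷ y) → y ≡ map not x
commonNeighbour-tail p≢q (inj₁ hypP , inj₁ hypQ) = ⊥-elim (¬hypercubeAdj×hypercubeAdj p≢q hypP hypQ)
commonNeighbour-tail {c = c} {y} _ (inj₁ hyp , inj₂ comp) =
  ⊥-elim (¬hypercubeAdj×complementAdj {w = c ∷ y} hyp comp)
commonNeighbour-tail {c = c} {y} _ (inj₂ comp , inj₁ hyp) =
  ⊥-elim (¬hypercubeAdj×complementAdj {w = c ∷ y} hyp comp)
commonNeighbour-tail p≢q (inj₂ compP , inj₂ compQ)
  with complementAdj-∷⁻ compP | complementAdj-∷⁻ compQ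
... | inj₂ tail≡ | _          = tail≡
... | _          | inj₂ tail≡ = tail≡
... | inj₁ p≡c   | inj₁ q≡c   = ⊥-elim (p≢q (trans p≡c (sym q≡c)))

record ThreeCommonNeighbours (a b : V n) : Set where
  field
    w₁ w₂ w₃ : V n
    common₁ : CommonNeighbour a b w₁
    common₂ : CommonNeighbour a b w₂
    common₃ : CommonNeighbour a b w₃
    w₁≢w₂ : w₁ ≢ w₂
    w₁≢w₃ : w₁ ≢ w₃
    w₂≢w₃ : w₂ ≢ w₃

bool-pigeonhole : (a b c : Bool) → a ≡ b ⊎ a ≡ c ⊎ b ≡ c
bool-pigeonhole false false _     = inj₁ refl
bool-pigeonhole true  true  _     = inj₁ refl
bool-pigeonhole false true  false = inj₂ (inj₁ refl)
bool-pigeonhole true  false true  = inj₂ (inj₁ refl)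
bool-pigeonhole false true  true  = inj₂ (inj₂ refl)
bool-pigeonhole true  false false = inj₂ (inj₂ refl)

commonNeighbour-head-injective : {x : V (suc (suc n))} {w w′ : V (3 + n)} → p ≢ q →
                                 CommonNeighbour (p ∷ x) (q ∷ x) w →
                                 CommonNeighbour (p ∷ x) (q ∷ x) w′ →
                                 head w ≡ head w′ → w ≡ w′
commonNeighbour-head-injective {w = c ∷ _} {_ ∷ _} p≢q common common′ refl =
  cong (c ∷_) (trans (commonNeighbour-tail p≢q common) (sym (commonNeighbour-tail p≢q common′)))

¬threeCommonNeighbours : {x : V (suc (suc n))} → p ≢ q → ¬ ThreeCommonNeighbours (p ∷ x) (q ∷ x)
¬threeCommonNeighbours {p = p} {q} {x = x} p≢q three =
  [ w₁≢w₂ ∘ same common₁ common₂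
  , [ w₁≢w₃ ∘ same common₁ common₃ , w₂≢w₃ ∘ same common₂ common₃ ]′
  ]′
    (bool-pigeonhole (head w₁) (head w₂) (head w₃))
  where
  open ThreeCommonNeighbours three
  same : ∀ {w w′} → CommonNeighbour (p ∷ x) (q ∷ x) w → CommonNeighbour (p ∷ x) (q ∷ x) w′ →
         head w ≡ head w′ → w ≡ w′
  same = commonNeighbour-head-injective p≢q

threeCommonNeighbours-map : ∀ {n′} {a b : V n} (f : V n → V n′) → Injective _≡_ _≡_ f →
                            (∀ u v → Adj u v → Adj (f u) (f v)) →
                            ThreeCommonNeighbours a b → ThreeCommonNeighbours (f a) (f b)
threeCommonNeighbours-map {a = a} {b} f f-injective f-adj three = record
  { w₁ = f w₁ ; w₂ = f w₂ ; w₃ = f w₃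
  ; common₁ = common common₁ ; common₂ = common common₂ ; common₃ = common common₃
  ; w₁≢w₂ = w₁≢w₂ ∘ f-injective
  ; w₁≢w₃ = w₁≢w₃ ∘ f-injective
  ; w₂≢w₃ = w₂≢w₃ ∘ f-injective
  }
  where
  open ThreeCommonNeighbours three
  common : ∀ {w} → CommonNeighbour a b w → CommonNeighbour (f a) (f b) (f w)
  common {w} (aw , bw) = f-adj a w aw , f-adj b w bw

threeCommonNeighbours-swap : {a b : V n} → ThreeCommonNeighbours a b → ThreeCommonNeighbours b a
threeCommonNeighbours-swap three = record
  { w₁ = w₁ ; w₂ = w₂ ; w₃ = w₃
  ; common₁ = swap common₁ ; common₂ = swap common₂ ; common₃ = swap common₃
  ; w₁≢w₂ = w₁≢w₂ ; w₁≢w₃ = w₁≢w₃ ; w₂≢w₃ = w₂≢w₃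
  }
  where open ThreeCommonNeighbours three

threeCommonNeighbours-automorphism : {a b : V n} {f : V n → V n} → IsAutomorphism n f →
                                     ThreeCommonNeighbours a b → ThreeCommonNeighbours (f a) (f b)
threeCommonNeighbours-automorphism {f = f} ((f-injective , _) , f-adj) =
  threeCommonNeighbours-map f f-injective (λ u v → Equivalence.to (f-adj u v))

edgeTransitive⇒threeCommonNeighbours : EdgeTransitive n → {a b x y : V n} → Adj a b → Adj x y →
                                       ThreeCommonNeighbours a b → ThreeCommonNeighbours x y
edgeTransitive⇒threeCommonNeighbours et {a} {b} {x} {y} ab xy three with et a b x y ab xy
... | f , f-automorphism , inj₁ (fa≡x , fb≡y) =
  subst₂ ThreeCommonNeighbours fa≡x fb≡y (threeCommonNeighbours-automorphism f-automorphism three)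
... | f , f-automorphism , inj₂ (fa≡y , fb≡x) =
  subst₂ ThreeCommonNeighbours fb≡x fa≡y
    (threeCommonNeighbours-swap (threeCommonNeighbours-automorphism f-automorphism three))

threeCommonNeighbours-AQ₃ :
  ThreeCommonNeighbours (false ∷ false ∷ false ∷ []) (false ∷ true ∷ true ∷ [])
threeCommonNeighbours-AQ₃ = record
  { w₁ = true ∷ false ∷ false ∷ []
  ; w₂ = false ∷ true ∷ false ∷ []
  ; w₃ = false ∷ false ∷ true ∷ []
  ; common₁ = inj₁ (hypercubeAdj-updateAt a zero) , inj₂ (complementAdj-map-not b)
  ; common₂ = inj₁ (hypercubeAdj-updateAt a (suc zero)) , inj₁ (hypercubeAdj-updateAt b (suc (suc zero)))
  ; common₃ = inj₁ (hypercubeAdj-updateAt a (suc (suc zero))) , inj₁ (hypercubeAdj-updateAt b (suc zero))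
  ; w₁≢w₂ = λ () ; w₁≢w₃ = λ () ; w₂≢w₃ = λ ()
  }
  where
  a b : V 3
  a = false ∷ false ∷ false ∷ []
  b = false ∷ true ∷ true ∷ []

edgeWithThreeCommonNeighbours : ∀ m → ∃₂ λ (a b : V (3 + m)) → Adj a b × ThreeCommonNeighbours a b
edgeWithThreeCommonNeighbours zero =
  _ , _ , adj-∷⁺ (inj₂ (complementAdj-map-not (false ∷ false ∷ []))) , threeCommonNeighbours-AQ₃
edgeWithThreeCommonNeighbours (suc m) =
  let a , b , ab , three = edgeWithThreeCommonNeighbours m
  in false ∷ a , false ∷ b , adj-∷⁺ {u = a} {b} ab ,
     threeCommonNeighbours-map (false ∷_) ∷-injectiveʳ (λ u v → adj-∷⁺ {u = u} {v}) three

¬edgeTransitive : ∀ m → ¬ EdgeTransitive (3 + m)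
¬edgeTransitive m et =
  let a , b , ab , three = edgeWithThreeCommonNeighbours m
  in ¬threeCommonNeighbours (λ ()) (edgeTransitive⇒threeCommonNeighbours et ab edge three)
  where
  zeros = replicate (2 + m) false
  edge : Adj (false ∷ zeros) (true ∷ zeros)
  edge = inj₁ (hypercubeAdj-updateAt (false ∷ zeros) zero)

proposition7p4 : (∀ (n : ℕ) → 1 ≤ n → n ≤ 2 → ArcTransitive n)
    × (∀ (n : ℕ) → 3 ≤ n → ¬ ArcTransitive n × ¬ EdgeTransitive n)
proposition7p4 = small , large
  where
  small : ∀ (n : ℕ) → 1 ≤ n → n ≤ 2 → ArcTransitive n
  small 1 _ _ = complete⇒arcTransitive AQ₁-complete
  small 2 _ _ = complete⇒arcTransitive AQ₂-complete
  small (suc (suc (suc _))) _ (s≤s (s≤s ()))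
  large : ∀ (n : ℕ) → 3 ≤ n → ¬ ArcTransitive n × ¬ EdgeTransitive n
  large (suc (suc (suc m))) _ = ¬edgeTransitive m ∘ arcTransitive⇒edgeTransitive , ¬edgeTransitive m
  large 1 (s≤s ())
  large 2 (s≤s (s≤s ()))
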